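{- Let $A_0,B_0\subseteq\mathbb{N}_0$ and let $(m_i)_{i\ge 0}$ be a sequence of non-negative integers. For $i=1,2,\dots$ define recursively $A_i := A_{i-1}\cup (m_{i-1}+B_{i-1})$ and $B_i := B_{i-1}\cup (m_{i-1}+A_{i-1})$, and let $A:=\bigcup_{i\ge 0}A_i$, $B:=\bigcup_{i\ge 0}B_i$. If $R_{A_0}=R_{B_0}$ and $m_i\notin(A_i-B_i)\cup(B_i-A_i)$ for every $i\ge 0$, then $R_A=R_B$.
   Context: $\mathbb{N}_0$ denotes the set of non-negative integers. For $A\subseteq\mathbb{N}_0$, the representation function $R_A$ is defined for each integer $n$ by $R_A(n):=|\{(a',a'')\in A\times A : n=a'+a'',\ a'<a''\}|$. For sets $X,Y$ of integers, $X-Y:=\{x-y : x\in X,\ y\in Y\}$, and for an integer $m$, $m+X:=\{m+x: x\in X\}$. -}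

module Defs where

open import Level using (0ℓ)
open import Data.Nat using (ℕ; zero; suc; _+_; _<_)
open import Data.Integer using (ℤ; +_; _-_)
open import Data.Product using (Σ; ∃; _×_; _,_; proj₁; proj₂)
open import Data.Sum using (_⊎_)
open import Data.List using (List; length)
open import Data.List.Membership.Propositional using (_∈_)
open import Data.List.Relation.Unary.Unique.Propositional using (Unique)
open import Relation.Binary.PropositionalEquality using (_≡_)
open import Relation.Unary using (Pred; _∪_)
open import Function.Bundles using (_⇔_)

SetN : Set₁
SetN = Pred ℕ 0ℓ

_+ₛ_ : ℕ → SetN → SetN
(m +ₛ X) y = ∃ λ x → X x × y ≡ m + x

_−ₛ_ : SetN → SetN → Pred ℤ 0ℓ
(X −ₛ Y) z = ∃ λ x → ∃ λ y → X x × Y y × z ≡ (+ x) - (+ y)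

RepPairs : SetN → ℕ → Pred (ℕ × ℕ) 0ℓ
RepPairs A n (a₁ , a₂) = A a₁ × A a₂ × n ≡ a₁ + a₂ × a₁ < a₂

-- A predicate P on a type has exactly k elements: it is listed by a
-- duplicate-free list of length k.
HasSize : {X : Set} → Pred X 0ℓ → ℕ → Set
HasSize {X} P k = Σ (List X) λ xs → Unique xs × length xs ≡ k × (∀ x → P x ⇔ (x ∈ xs))

RepCount : SetN → ℕ → ℕ → Set
RepCount A n k = HasSize (RepPairs A n) k

SameRep : SetN → SetN → Set
SameRep A B = ∀ n k → RepCount A n k ⇔ RepCount B n k

AB : SetN → SetN → (ℕ → ℕ) → ℕ → SetN × SetN
AB A₀ B₀ m zero = A₀ , B₀
AB A₀ B₀ m (suc i) =
  let Ai = proj₁ (AB A₀ B₀ m i)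
      Bi = proj₂ (AB A₀ B₀ m i)
  in (Ai ∪ (m i +ₛ Bi)) , (Bi ∪ (m i +ₛ Ai))

Aseq : SetN → SetN → (ℕ → ℕ) → ℕ → SetN
Aseq A₀ B₀ m i = proj₁ (AB A₀ B₀ m i)

Bseq : SetN → SetN → (ℕ → ℕ) → ℕ → SetN
Bseq A₀ B₀ m i = proj₂ (AB A₀ B₀ m i)

Alim : SetN → SetN → (ℕ → ℕ) → SetN
Alim A₀ B₀ m x = ∃ λ i → Aseq A₀ B₀ m i x

Blim : SetN → SetN → (ℕ → ℕ) → SetN
Blim A₀ B₀ m x = ∃ λ i → Bseq A₀ B₀ m i x

-- Equal representation functions are preserved by the doubling
-- construction A ↦ A ∪ (m + B), B ↦ B ∪ (m + A) and by increasing unions.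
--
-- If A and m + B are disjoint (that is, m ∉ A − B), the
-- representations of n by A ∪ (m + B) are in bijection with the disjoint sum
-- of those by A, those by m + B, and the cross pairs (a , b) ∈ A × B with
-- a + m + b = n.  Translation by m shifts R, so R_{m+B} = R_{m+A}, and
-- swapping matches the cross pairs of (A , B) with those of (B , A); hence
-- R_A = R_B gives R_{A ∪ (m+B)} = R_{B ∪ (m+A)}.
--
-- Each R_A(n) involves finitely many pairs, all of which occur at a
-- single stage N; from N on the counts of the A_i are R_A(n), so the counts
-- of the B_i stabilise, and by the subpredicate fact the representations by
-- B_N already are all representations by B.

module Submission where

open import Defs
open import Level using (0ℓ)
open import Data.Empty using (⊥-elim)
open import Data.Nat using (ℕ; zero; suc; _+_; _∸_; _≟_; _<_; _≤_; _⊔_; _≤?_; _<?_; _≤′_; ≤′-refl; ≤′-step)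
open import Data.Nat.Properties
open import Data.Nat.Solver using (module +-*-Solver)
open import Data.Integer as ℤ using (+_; _⊖_)
open import Data.Integer.Properties using ([+m]-[+n]≡m⊖n; ⊖-≥)
open import Data.Sum using (_⊎_; inj₁; inj₂)
open import Data.Sum.Properties using (inj₁-injective; inj₂-injective)
open import Data.Product using (Σ; ∃; ∃₂; _×_; _,_; proj₁; proj₂; swap)
open import Data.Product.Properties using (,-injective; ≡-dec)
open import Data.List using (List; []; _∷_; _++_; map; length)
open import Data.List.Properties using (length-++; length-map)
open import Data.List.Membership.Propositional using (_∈_; mapWith∈)
open import Data.List.Membership.Propositional.Properties using (∈-map⁺; ∈-map⁻; ∈-++⁺ˡ; ∈-++⁺ʳ; ∈-++⁻)
open import Data.List.Membership.Setoid.Properties using (length-mapWith∈)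
open import Data.List.Membership.DecPropositional using (_∈?_)
open import Data.List.Relation.Unary.Any using (here; there)
open import Data.List.Relation.Unary.Any.Properties using (mapWith∈⁺; mapWith∈⁻)
import Data.List.Relation.Unary.All as All
open import Data.List.Relation.Unary.Unique.Propositional using (Unique; []; _∷_)
open import Data.List.Relation.Unary.Unique.Propositional.Properties using (map⁺; ++⁺)
open import Data.List.Fresh as Fresh using (fromList)
import Data.List.Fresh.Relation.Unary.Any as FreshAny
import Data.List.Fresh.Membership.Setoid as FreshMembership
open import Data.List.Fresh.Membership.Setoid.Properties using (strict-injection)
open import Function using (_∘_; id)
open import Function.Bundles using (_⇔_; mk⇔; Equivalence)
open import Function.Properties.Equivalence using () renaming (sym to ⇔-sym)
open import Relation.Binary.Definitions using (DecidableEquality; tri<; tri≈; tri>)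
open import Relation.Binary.PropositionalEquality
open import Relation.Nullary using (¬_; yes; no)
open import Relation.Unary using (Pred; Empty; _⊆_; _≐_; _∪_; _⊥_; ⋃; _⟨×⟩_; _⟨⊎⟩_)

open Equivalence using (to; from)

private
  variable
    X Y : Set
    P P′ : Pred X 0ℓ
    Q Q′ : Pred Y 0ℓ
    A B : SetN
    m n k : ℕ

Pair : Set
Pair = ℕ × ℕ

SizeTransfer : Pred X 0ℓ → Pred Y 0ℓ → Set
SizeTransfer P Q = ∀ {k} → HasSize P k → HasSize Q k

mapWith∈-unique : (xs : List X) (f : ∀ {x} → x ∈ xs → Y) →
  (∀ {x y} (x∈ : x ∈ xs) (y∈ : y ∈ xs) → f x∈ ≡ f y∈ → x ≡ y) →
  Unique xs → Unique (mapWith∈ xs f)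
mapWith∈-unique [] f f-inj [] = []
mapWith∈-unique (x ∷ xs) f f-inj (x∉xs ∷ xs-unique) =
  All.tabulate fresh ∷ mapWith∈-unique xs (f ∘ there) (λ p q → f-inj (there p) (there q)) xs-unique
  where
    fresh : ∀ {z} → z ∈ mapWith∈ xs (f ∘ there) → f (here refl) ≢ z
    fresh z∈ fx≡z with mapWith∈⁻ xs (f ∘ there) z∈
    ... | y , y∈xs , refl = All.lookup x∉xs y∈xs (f-inj (here refl) (there y∈xs) fx≡z)

record Correspondence (P : Pred X 0ℓ) (Q : Pred Y 0ℓ) : Set where
  field
    image      : ∀ {x} → P x → Y
    image-irr  : ∀ {x} (p p′ : P x) → image p ≡ image p′
    image-∈    : ∀ {x} (p : P x) → Q (image p)
    image-inj  : ∀ {x x′} (p : P x) (p′ : P x′) → image p ≡ image p′ → x ≡ x′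
    image-onto : ∀ {y} → Q y → ∃ λ x → Σ (P x) λ p → image p ≡ y

correspondence-size : {P : Pred X 0ℓ} {Q : Pred Y 0ℓ} → Correspondence P Q → SizeTransfer P Q
correspondence-size {Y = Y} {P = P} {Q = Q} c (xs , xs-unique , xs-length , xs-lists) =
  ys , mapWith∈-unique xs f (λ _ _ → image-inj _ _) xs-unique ,
  trans (length-mapWith∈ (setoid _) xs) xs-length , λ y → mk⇔ listed (listed⁻ y)
  where
    open Correspondence c
    f : ∀ {x} → x ∈ xs → Y
    f x∈ = image (from (xs-lists _) x∈)
    ys : List Y
    ys = mapWith∈ xs f
    listed : ∀ {y} → Q y → y ∈ ys
    listed q with image-onto q
    ... | x , p , refl = mapWith∈⁺ f (x , to (xs-lists x) p , image-irr p _)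
    listed⁻ : ∀ y → y ∈ ys → Q y
    listed⁻ y y∈ with mapWith∈⁻ xs f y∈
    ... | _ , _ , refl = image-∈ _

record BijOn (g : X → Y) (P : Pred X 0ℓ) (Q : Pred Y 0ℓ) : Set where
  field
    maps-to   : ∀ {x} → P x → Q (g x)
    injective : ∀ {x x′} → P x → P x′ → g x ≡ g x′ → x ≡ x′
    onto      : ∀ {y} → Q y → ∃ λ x → P x × g x ≡ y

-- Bijective predicates have the same sizes: g and its inverse (which
-- depends on the witness of Q) are both correspondences.
bijOn-size : {g : X → Y} → BijOn g P Q → ∀ {k} → HasSize P k ⇔ HasSize Q k
bijOn-size {X = X} {P = P} {Q = Q} {g = g} b = mk⇔ (correspondence-size forward) (correspondence-size backward)
  where
    open BijOn b
    forward : Correspondence P Q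
    forward = record
      { image = λ {x} _ → g x ; image-irr = λ _ _ → refl ; image-∈ = maps-to
      ; image-inj = injective ; image-onto = onto }
    preimage : ∀ {y} → Q y → X
    preimage q = proj₁ (onto q)
    preimage-∈ : ∀ {y} (q : Q y) → P (preimage q)
    preimage-∈ q = proj₁ (proj₂ (onto q))
    preimage-sec : ∀ {y} (q : Q y) → g (preimage q) ≡ y
    preimage-sec q = proj₂ (proj₂ (onto q))
    backward : Correspondence Q P
    backward = record
      { image = preimage
      ; image-irr = λ q q′ → injective (preimage-∈ q) (preimage-∈ q′) (trans (preimage-sec q) (sym (preimage-sec q′)))
      ; image-∈ = preimage-∈
      ; image-inj = λ q q′ e → trans (sym (preimage-sec q)) (trans (cong g e) (preimage-sec q′))
      ; image-onto = λ {x} p → g x , maps-to p , injective (preimage-∈ (maps-to p)) p (preimage-sec (maps-to p)) }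

empty-size : Empty P → Empty Q → SizeTransfer P Q
empty-size ∅P ∅Q ([] , _ , refl , _) = [] , [] , refl , λ y → mk⇔ (⊥-elim ∘ ∅Q y) λ ()
empty-size ∅P ∅Q ((x ∷ _) , _ , _ , lists) = ⊥-elim (∅P x (from (lists x) (here refl)))

≐-size : P ≐ Q → SizeTransfer P Q
≐-size (P⊆Q , Q⊆P) (xs , u , len , lists) = xs , u , len , λ x → mk⇔ (to (lists x) ∘ Q⊆P) (P⊆Q ∘ from (lists x))

module _ {X Y : Set} where

  lefts : List (X ⊎ Y) → List X
  lefts [] = []
  lefts (inj₁ x ∷ zs) = x ∷ lefts zs
  lefts (inj₂ _ ∷ zs) = lefts zs

  rights : List (X ⊎ Y) → List Y
  rights [] = []
  rights (inj₁ _ ∷ zs) = rights zs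
  rights (inj₂ y ∷ zs) = y ∷ rights zs

  length-lefts+rights : ∀ zs → length (lefts zs) + length (rights zs) ≡ length zs
  length-lefts+rights [] = refl
  length-lefts+rights (inj₁ x ∷ zs) = cong suc (length-lefts+rights zs)
  length-lefts+rights (inj₂ y ∷ zs) = trans (+-suc (length (lefts zs)) _) (cong suc (length-lefts+rights zs))

  ∈-lefts⁺ : ∀ {x zs} → inj₁ x ∈ zs → x ∈ lefts zs
  ∈-lefts⁺ {zs = inj₁ _ ∷ _} (here refl) = here refl
  ∈-lefts⁺ {zs = inj₁ _ ∷ _} (there x∈) = there (∈-lefts⁺ x∈)
  ∈-lefts⁺ {zs = inj₂ _ ∷ _} (there x∈) = ∈-lefts⁺ x∈

  ∈-lefts⁻ : ∀ {x zs} → x ∈ lefts zs → inj₁ x ∈ zs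
  ∈-lefts⁻ {zs = inj₁ _ ∷ _} (here refl) = here refl
  ∈-lefts⁻ {zs = inj₁ _ ∷ _} (there x∈) = there (∈-lefts⁻ x∈)
  ∈-lefts⁻ {zs = inj₂ _ ∷ _} x∈ = there (∈-lefts⁻ x∈)

  ∈-rights⁺ : ∀ {y zs} → inj₂ y ∈ zs → y ∈ rights zs
  ∈-rights⁺ {zs = inj₂ _ ∷ _} (here refl) = here refl
  ∈-rights⁺ {zs = inj₂ _ ∷ _} (there y∈) = there (∈-rights⁺ y∈)
  ∈-rights⁺ {zs = inj₁ _ ∷ _} (there y∈) = ∈-rights⁺ y∈

  ∈-rights⁻ : ∀ {y zs} → y ∈ rights zs → inj₂ y ∈ zs
  ∈-rights⁻ {zs = inj₂ _ ∷ _} (here refl) = here refl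
  ∈-rights⁻ {zs = inj₂ _ ∷ _} (there y∈) = there (∈-rights⁻ y∈)
  ∈-rights⁻ {zs = inj₁ _ ∷ _} y∈ = there (∈-rights⁻ y∈)

  lefts-unique : ∀ {zs} → Unique zs → Unique (lefts zs)
  lefts-unique {[]} [] = []
  lefts-unique {inj₁ x ∷ zs} (fresh ∷ u) =
    All.tabulate (λ x′∈ x≡x′ → All.lookup fresh (∈-lefts⁻ x′∈) (cong inj₁ x≡x′)) ∷ lefts-unique u
  lefts-unique {inj₂ _ ∷ zs} (_ ∷ u) = lefts-unique u

  rights-unique : ∀ {zs} → Unique zs → Unique (rights zs)
  rights-unique {[]} [] = []
  rights-unique {inj₂ y ∷ zs} (fresh ∷ u) =
    All.tabulate (λ y′∈ y≡y′ → All.lookup fresh (∈-rights⁻ y′∈) (cong inj₂ y≡y′)) ∷ rights-unique u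
  rights-unique {inj₁ _ ∷ zs} (_ ∷ u) = rights-unique u

  ⊎-split : {P : Pred X 0ℓ} {Q : Pred Y 0ℓ} → HasSize (P ⟨⊎⟩ Q) k →
    ∃₂ λ k₁ k₂ → HasSize P k₁ × HasSize Q k₂ × k₁ + k₂ ≡ k
  ⊎-split (zs , u , refl , lists) =
    _ , _ ,
    (lefts zs , lefts-unique u , refl , λ x → mk⇔ (∈-lefts⁺ ∘ to (lists (inj₁ x))) (from (lists (inj₁ x)) ∘ ∈-lefts⁻)) ,
    (rights zs , rights-unique u , refl , λ y → mk⇔ (∈-rights⁺ ∘ to (lists (inj₂ y))) (from (lists (inj₂ y)) ∘ ∈-rights⁻)) ,
    length-lefts+rights zs

  ⊎-join : {P : Pred X 0ℓ} {Q : Pred Y 0ℓ} {k₁ k₂ : ℕ} →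
    HasSize P k₁ → HasSize Q k₂ → HasSize (P ⟨⊎⟩ Q) (k₁ + k₂)
  ⊎-join {P = P} {Q} (xs , xs-unique , refl , xs-lists) (ys , ys-unique , refl , ys-lists) =
    zs , ++⁺ (map⁺ inj₁-injective xs-unique) (map⁺ inj₂-injective ys-unique) apart ,
    trans (length-++ (map inj₁ xs)) (cong₂ _+_ (length-map inj₁ xs) (length-map inj₂ ys)) , lists
    where
      zs : List (X ⊎ Y)
      zs = map inj₁ xs ++ map inj₂ ys
      apart : ∀ {z} → ¬ (z ∈ map inj₁ xs × z ∈ map inj₂ ys)
      apart (z∈ˡ , z∈ʳ) with ∈-map⁻ inj₁ z∈ˡ | ∈-map⁻ inj₂ z∈ʳ
      ... | _ , _ , refl | _ , _ , ()
      lists : ∀ z → (P ⟨⊎⟩ Q) z ⇔ (z ∈ zs)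
      lists (inj₁ x) = mk⇔ (∈-++⁺ˡ ∘ ∈-map⁺ inj₁ ∘ to (xs-lists x)) (from (xs-lists x) ∘ left)
        where
          left : inj₁ x ∈ zs → x ∈ xs
          left z∈ with ∈-++⁻ (map inj₁ xs) z∈
          ... | inj₁ z∈ˡ with ∈-map⁻ inj₁ z∈ˡ
          ...   | _ , x∈ , refl = x∈
          left z∈ | inj₂ z∈ʳ with ∈-map⁻ inj₂ z∈ʳ
          ...   | _ , _ , ()
      lists (inj₂ y) = mk⇔ (∈-++⁺ʳ (map inj₁ xs) ∘ ∈-map⁺ inj₂ ∘ to (ys-lists y)) (from (ys-lists y) ∘ right)
        where
          right : inj₂ y ∈ zs → y ∈ ys
          right z∈ with ∈-++⁻ (map inj₁ xs) z∈
          ... | inj₁ z∈ˡ with ∈-map⁻ inj₁ z∈ˡ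
          ...   | _ , _ , ()
          right z∈ | inj₂ z∈ʳ with ∈-map⁻ inj₂ z∈ʳ
          ...   | _ , y∈ , refl = y∈

⊎-transfer : SizeTransfer P P′ → SizeTransfer Q Q′ → SizeTransfer (P ⟨⊎⟩ Q) (P′ ⟨⊎⟩ Q′)
⊎-transfer P⇛P′ Q⇛Q′ s with ⊎-split s
... | _ , _ , p , q , refl = ⊎-join (P⇛P′ p) (Q⇛Q′ q)

module _ {X : Set} (_≟_ : DecidableEquality X) where

  open FreshMembership (setoid X) using () renaming (_∈_ to _∈#_)

  ∈-fromList⁺ : ∀ {x} {xs : List X} (u : Unique xs) → x ∈ xs → x ∈# fromList u
  ∈-fromList⁺ (_ ∷ _) (here x≡y) = FreshAny.here x≡y
  ∈-fromList⁺ (_ ∷ u) (there x∈) = FreshAny.there (∈-fromList⁺ u x∈)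

  ∈-fromList⁻ : ∀ {x} {xs : List X} (u : Unique xs) → x ∈# fromList u → x ∈ xs
  ∈-fromList⁻ (_ ∷ _) (FreshAny.here x≡y) = here x≡y
  ∈-fromList⁻ (_ ∷ u) (FreshAny.there x∈) = there (∈-fromList⁻ u x∈)

  length-fromList : {xs : List X} (u : Unique xs) → Fresh.length (fromList u) ≡ length xs
  length-fromList [] = refl
  length-fromList (_ ∷ u) = cong suc (length-fromList u)

  -- If P ⊆ Q have the same size, any element of Q missing from the listing
  -- of P would make the listing of Q strictly longer.
  full-subpredicate : {P Q : Pred X 0ℓ} → P ⊆ Q → HasSize P k → HasSize Q k → Q ⊆ P
  full-subpredicate {P} {Q} P⊆Q (xs , xs-unique , xs-length , xs-lists) (ys , ys-unique , ys-length , ys-lists) {y} q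
    with _∈?_ _≟_ y xs
  ... | yes y∈xs = from (xs-lists y) y∈xs
  ... | no y∉xs = ⊥-elim (<-irrefl same-length (strict-injection (setoid X) id xs⊆ys missing))
    where
      xs⊆ys : ∀ {x} → x ∈# fromList xs-unique → x ∈# fromList ys-unique
      xs⊆ys x∈ = ∈-fromList⁺ ys-unique (to (ys-lists _) (P⊆Q (from (xs-lists _) (∈-fromList⁻ xs-unique x∈))))
      missing : ∃ λ z → z ∈# fromList ys-unique × ¬ z ∈# fromList xs-unique
      missing = y , ∈-fromList⁺ ys-unique (to (ys-lists y) q) , y∉xs ∘ ∈-fromList⁻ xs-unique
      same-length : Fresh.length (fromList xs-unique) ≡ Fresh.length (fromList ys-unique)
      same-length = trans (length-fromList xs-unique) (trans xs-length (sym (trans (length-fromList ys-unique) ys-length)))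

RepTransfer : SetN → SetN → Set
RepTransfer A B = ∀ n → SizeTransfer (RepPairs A n) (RepPairs B n)

sameRep⇒transfer : SameRep A B → RepTransfer A B
sameRep⇒transfer same n {k} = to (same n k)

transfers⇒sameRep : RepTransfer A B → RepTransfer B A → SameRep A B
transfers⇒sameRep A⇛B B⇛A n k = mk⇔ (A⇛B n) (B⇛A n)

sameRep-sym : SameRep A B → SameRep B A
sameRep-sym same n k = ⇔-sym (same n k)

repPairs-mono : A ⊆ B → RepPairs A n ⊆ RepPairs B n
repPairs-mono A⊆B (a₁ , a₂ , e , lt) = A⊆B a₁ , A⊆B a₂ , e , lt

-- Translation: n = a + b with a < b iff 2m + n = (m + a) + (m + b) with
-- m + a < m + b, and numbers below 2m have no representation by m + X.
shift-pair : ℕ → Pair → Pair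
shift-pair m (a , b) = m + a , m + b

shift-sum : ∀ m a b → (m + a) + (m + b) ≡ (m + m) + (a + b)
shift-sum = solve 3 (λ m a b → (m :+ a) :+ (m :+ b) := (m :+ m) :+ (a :+ b)) refl
  where open +-*-Solver

shift-bijOn : ∀ (X : SetN) m n → BijOn (shift-pair m) (RepPairs X n) (RepPairs (m +ₛ X) ((m + m) + n))
shift-bijOn X m n = record { maps-to = maps-to ; injective = injective ; onto = onto }
  where
    maps-to : ∀ {p} → RepPairs X n p → RepPairs (m +ₛ X) ((m + m) + n) (shift-pair m p)
    maps-to {a , b} (xa , xb , refl , a<b) =
      (a , xa , refl) , (b , xb , refl) , sym (shift-sum m a b) , +-monoʳ-< m a<b
    injective : ∀ {p p′} → RepPairs X n p → RepPairs X n p′ → shift-pair m p ≡ shift-pair m p′ → p ≡ p′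
    injective {a , b} {a′ , b′} _ _ e with ,-injective e
    ... | ma≡ma′ , mb≡mb′ = cong₂ _,_ (+-cancelˡ-≡ m a a′ ma≡ma′) (+-cancelˡ-≡ m b b′ mb≡mb′)
    onto : ∀ {q} → RepPairs (m +ₛ X) ((m + m) + n) q → ∃ λ p → RepPairs X n p × shift-pair m p ≡ q
    onto ((a , xa , refl) , (b , xb , refl) , e , lt) =
      (a , b) , (xa , xb , +-cancelˡ-≡ (m + m) n (a + b) (trans e (shift-sum m a b)) , +-cancelˡ-< m a b lt) , refl

shift-too-small : ∀ (X : SetN) → n < m + m → Empty (RepPairs (m +ₛ X) n)
shift-too-small {n} {m} X n<2m _ ((a , _ , refl) , (b , _ , refl) , e , _) =
  <⇒≱ n<2m (subst (m + m ≤_) (sym e) (+-mono-≤ (m≤m+n m a) (m≤m+n m b)))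

shift-transfer : RepTransfer A B → RepTransfer (m +ₛ A) (m +ₛ B)
shift-transfer {A} {B} {m} A⇛B n with m + m ≤? n
... | no 2m≰n = empty-size (shift-too-small A (≰⇒> 2m≰n)) (shift-too-small B (≰⇒> 2m≰n))
... | yes 2m≤n with m≤n⇒∃[o]m+o≡n 2m≤n
...   | d , refl = λ r → to (bijOn-size (shift-bijOn B m d)) (A⇛B d (from (bijOn-size (shift-bijOn A m d)) r))

sort : ℕ → ℕ → Pair
sort a c with a <? c
... | yes _ = a , c
... | no _ = c , a

sort-< : ∀ {a c} → a < c → sort a c ≡ (a , c)
sort-< {a} {c} a<c with a <? c
... | yes _ = refl
... | no a≮c = ⊥-elim (a≮c a<c)

sort-> : ∀ {a c} → c < a → sort a c ≡ (c , a)
sort-> {a} {c} c<a with a <? c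
... | yes a<c = ⊥-elim (<-asym a<c c<a)
... | no _ = refl

sort-cases : ∀ a c → sort a c ≡ (a , c) ⊎ sort a c ≡ (c , a)
sort-cases a c with a <? c
... | yes _ = inj₁ refl
... | no _ = inj₂ refl

sort-injective : ∀ {a c a′ c′} → sort a c ≡ sort a′ c′ → (a ≡ a′ × c ≡ c′) ⊎ (a ≡ c′ × c ≡ a′)
sort-injective {a} {c} {a′} {c′} e with sort-cases a c | sort-cases a′ c′
... | inj₁ s | inj₁ s′ = inj₁ (,-injective (trans (sym s) (trans e s′)))
... | inj₁ s | inj₂ s′ = inj₂ (,-injective (trans (sym s) (trans e s′)))
... | inj₂ s | inj₁ s′ = inj₂ (swap (,-injective (trans (sym s) (trans e s′))))
... | inj₂ s | inj₂ s′ = inj₁ (swap (,-injective (trans (sym s) (trans e s′))))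

Entry : ℕ → Pair → Set
Entry z (x , y) = z ≡ x ⊎ z ≡ y

sort-entryˡ : ∀ a c → Entry a (sort a c)
sort-entryˡ a c with a <? c
... | yes _ = inj₁ refl
... | no _ = inj₂ refl

sort-entryʳ : ∀ a c → Entry c (sort a c)
sort-entryʳ a c with a <? c
... | yes _ = inj₂ refl
... | no _ = inj₁ refl

entry-∈ : (S : SetN) {p : Pair} {z : ℕ} → (S ⟨×⟩ S) p → Entry z p → S z
entry-∈ S (sx , _) (inj₁ refl) = sx
entry-∈ S (_ , sy) (inj₂ refl) = sy

-- Cross pairs: (a , b) ∈ A × B with a + (m + b) = n.  They account for the
-- representations of n by A ∪ (m + B) using one summand from each part.
Cross : SetN → SetN → ℕ → ℕ → Pred Pair 0ℓ
Cross A B m n (a , b) = A a × B b × n ≡ a + (m + b)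

cross-swap : ∀ A B m n → BijOn swap (Cross A B m n) (Cross B A m n)
cross-swap A B m n = record
  { maps-to = λ { {a , b} (aa , bb , e) → bb , aa , trans e (exchange a b) }
  ; injective = λ _ _ e → cong swap e
  ; onto = λ { {b , a} (bb , aa , e) → (a , b) , (aa , bb , trans e (exchange b a)) , refl } }
  where
    exchange : ∀ a b → a + (m + b) ≡ b + (m + a)
    exchange a b = trans (+-comm a (m + b)) (trans (cong (_+ a) (+-comm m b)) (+-assoc b m a))

Parts : SetN → SetN → ℕ → ℕ → Pred (Pair ⊎ (Pair ⊎ Pair)) 0ℓ
Parts A B m n = RepPairs A n ⟨⊎⟩ (RepPairs (m +ₛ B) n ⟨⊎⟩ Cross A B m n)

assemble : ℕ → Pair ⊎ (Pair ⊎ Pair) → Pair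
assemble m (inj₁ p) = p
assemble m (inj₂ (inj₁ p)) = p
assemble m (inj₂ (inj₂ (a , b))) = sort a (m + b)

module Decomposition (A B : SetN) (m n : ℕ) (disjoint : A ⊥ (m +ₛ B)) where

  clash : ∀ {a b} → A a → B b → a ≢ m + b
  clash aa bb a≡m+b = disjoint (aa , _ , bb , a≡m+b)

  -- A cross pair gives a representation with one summand in A and one in
  -- m + B, in whichever order; they cannot be equal by disjointness.
  maps-to : ∀ {x} → Parts A B m n x → RepPairs (A ∪ (m +ₛ B)) n (assemble m x)
  maps-to {inj₁ _} (a₁ , a₂ , e , lt) = inj₁ a₁ , inj₁ a₂ , e , lt
  maps-to {inj₂ (inj₁ _)} (b₁ , b₂ , e , lt) = inj₂ b₁ , inj₂ b₂ , e , lt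
  maps-to {inj₂ (inj₂ (a , b))} (aa , bb , e) with <-cmp a (m + b)
  ... | tri< a<m+b _ _ rewrite sort-< a<m+b = inj₁ aa , inj₂ (b , bb , refl) , e , a<m+b
  ... | tri≈ _ a≡m+b _ = ⊥-elim (clash aa bb a≡m+b)
  ... | tri> _ _ m+b<a rewrite sort-> m+b<a = inj₂ (b , bb , refl) , inj₁ aa , trans e (+-comm a (m + b)) , m+b<a

  -- Pairs of different kinds are different: both entries of an A-pair lie
  -- in A, both entries of an (m + B)-pair in m + B, and a cross pair has
  -- one entry in each.
  AA-BB-apart : ∀ {p} → (A ⟨×⟩ A) p → ¬ ((m +ₛ B) ⟨×⟩ (m +ₛ B)) p
  AA-BB-apart (a₁ , _) (b₁ , _) = disjoint (a₁ , b₁)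

  AA≢cross : ∀ {p a b} → (A ⟨×⟩ A) p → Cross A B m n (a , b) → p ≢ sort a (m + b)
  AA≢cross {a = a} {b} both (_ , bb , _) refl = clash (entry-∈ A both (sort-entryʳ a (m + b))) bb refl

  BB≢cross : ∀ {p a b} → ((m +ₛ B) ⟨×⟩ (m +ₛ B)) p → Cross A B m n (a , b) → p ≢ sort a (m + b)
  BB≢cross {a = a} {b} both (aa , _ , _) refl = disjoint (aa , entry-∈ (m +ₛ B) both (sort-entryˡ a (m + b)))

  -- Equal images force equal kinds, and within a kind equal elements; for
  -- cross pairs sort-injective leaves only the case excluded by clash.
  injective : ∀ {x x′} → Parts A B m n x → Parts A B m n x′ → assemble m x ≡ assemble m x′ → x ≡ x′
  injective {inj₁ _} {inj₁ _} _ _ e = cong inj₁ e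
  injective {inj₂ (inj₁ _)} {inj₂ (inj₁ _)} _ _ e = cong (inj₂ ∘ inj₁) e
  injective {inj₂ (inj₂ (a , b))} {inj₂ (inj₂ (a′ , b′))} (aa , bb , _) (aa′ , bb′ , _) e with sort-injective e
  ... | inj₁ (a≡a′ , m+b≡m+b′) = cong (inj₂ ∘ inj₂) (cong₂ _,_ a≡a′ (+-cancelˡ-≡ m b b′ m+b≡m+b′))
  ... | inj₂ (a≡m+b′ , _) = ⊥-elim (clash aa bb′ a≡m+b′)
  injective {inj₁ _} {inj₂ (inj₁ _)} (a₁ , a₂ , _) (b₁ , b₂ , _) refl = ⊥-elim (AA-BB-apart (a₁ , a₂) (b₁ , b₂))
  injective {inj₂ (inj₁ _)} {inj₁ _} (b₁ , b₂ , _) (a₁ , a₂ , _) refl = ⊥-elim (AA-BB-apart (a₁ , a₂) (b₁ , b₂))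
  injective {inj₁ _} {inj₂ (inj₂ _)} (a₁ , a₂ , _) c e = ⊥-elim (AA≢cross (a₁ , a₂) c e)
  injective {inj₂ (inj₂ _)} {inj₁ _} c (a₁ , a₂ , _) e = ⊥-elim (AA≢cross (a₁ , a₂) c (sym e))
  injective {inj₂ (inj₁ _)} {inj₂ (inj₂ _)} (b₁ , b₂ , _) c e = ⊥-elim (BB≢cross (b₁ , b₂) c e)
  injective {inj₂ (inj₂ _)} {inj₂ (inj₁ _)} c (b₁ , b₂ , _) e = ⊥-elim (BB≢cross (b₁ , b₂) c (sym e))

  onto : ∀ {p} → RepPairs (A ∪ (m +ₛ B)) n p → ∃ λ x → Parts A B m n x × assemble m x ≡ p
  onto (inj₁ a₁ , inj₁ a₂ , e , lt) = inj₁ _ , (a₁ , a₂ , e , lt) , refl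
  onto (inj₂ b₁ , inj₂ b₂ , e , lt) = inj₂ (inj₁ _) , (b₁ , b₂ , e , lt) , refl
  onto (inj₁ aa , inj₂ (b , bb , refl) , e , lt) = inj₂ (inj₂ (_ , b)) , (aa , bb , e) , sort-< lt
  onto (inj₂ (b , bb , refl) , inj₁ aa , e , lt) =
    inj₂ (inj₂ (_ , b)) , (aa , bb , trans e (+-comm (m + b) _)) , sort-> lt

  bijOn : BijOn (assemble m) (Parts A B m n) (RepPairs (A ∪ (m +ₛ B)) n)
  bijOn = record { maps-to = λ {x} → maps-to {x} ; injective = λ {x} {x′} → injective {x} {x′} ; onto = onto }

step : SameRep A B → A ⊥ (m +ₛ B) → B ⊥ (m +ₛ A) → SameRep (A ∪ (m +ₛ B)) (B ∪ (m +ₛ A))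
step same A⊥m+B B⊥m+A = transfers⇒sameRep (one-way same A⊥m+B B⊥m+A) (one-way (sameRep-sym same) B⊥m+A A⊥m+B)
  where
    one-way : ∀ {A B m} → SameRep A B → A ⊥ (m +ₛ B) → B ⊥ (m +ₛ A) → RepTransfer (A ∪ (m +ₛ B)) (B ∪ (m +ₛ A))
    one-way {A} {B} {m} same A⊥m+B B⊥m+A n r =
      to (bijOn-size (Decomposition.bijOn B A m n B⊥m+A))
        (⊎-transfer (sameRep⇒transfer same n)
          (⊎-transfer (shift-transfer (sameRep⇒transfer (sameRep-sym same)) n) (to (bijOn-size (cross-swap A B m n))))
          (from (bijOn-size (Decomposition.bijOn A B m n A⊥m+B)) r))

record Increasing (F : ℕ → Pred X 0ℓ) : Set where
  constructor increasing
  field grow : ∀ {i} → F i ⊆ F (suc i)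

increasing-≤ : {F : ℕ → Pred X 0ℓ} → Increasing F → ∀ {i j} → i ≤ j → F i ⊆ F j
increasing-≤ {F = F} inc i≤j = go (≤⇒≤′ i≤j)
  where
    go : ∀ {i j} → i ≤′ j → F i ⊆ F j
    go ≤′-refl = id
    go (≤′-step i≤′j) = Increasing.grow inc ∘ go i≤′j

common-stage : {F : ℕ → Pred X 0ℓ} → Increasing F → (xs : List X) →
  (∀ {x} → x ∈ xs → ⋃ ℕ F x) → ∃ λ N → ∀ {x} → x ∈ xs → F N x
common-stage inc [] _ = 0 , λ ()
common-stage inc (x ∷ xs) in-⋃ with in-⋃ (here refl) | common-stage inc xs (in-⋃ ∘ there)
... | i , Fx | N , F-xs = i ⊔ N , λ { (here refl) → increasing-≤ inc (m≤m⊔n i N) Fx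
                                    ; (there x∈) → increasing-≤ inc (m≤n⊔m i N) (F-xs x∈) }

repPairs-increasing : {F : ℕ → SetN} → Increasing F → Increasing (λ i → RepPairs (F i) n)
repPairs-increasing inc = increasing λ {i} → repPairs-mono (λ {x} → Increasing.grow inc {i} {x})

repPairs-⋃⁺ : (F : ℕ → SetN) (i : ℕ) → RepPairs (F i) n ⊆ RepPairs (⋃ ℕ F) n
repPairs-⋃⁺ F i (a₁ , a₂ , e , lt) = (i , a₁) , (i , a₂) , e , lt

repPairs-⋃⁻ : {F : ℕ → SetN} → Increasing F → RepPairs (⋃ ℕ F) n ⊆ ⋃ ℕ (λ i → RepPairs (F i) n)
repPairs-⋃⁻ inc ((i , a₁) , (j , a₂) , e , lt) =
  i ⊔ j , increasing-≤ inc (m≤m⊔n i j) a₁ , increasing-≤ inc (m≤n⊔m i j) a₂ , e , lt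

limit-transfer : {F G : ℕ → SetN} → Increasing F → Increasing G →
  (∀ i → SameRep (F i) (G i)) → RepTransfer (⋃ ℕ F) (⋃ ℕ G)
limit-transfer {F = F} {G} incF incG same n {k} s@(xs , _ , _ , xs-lists) =
  ≐-size (repPairs-⋃⁺ G N , stable) (size-G ≤-refl)
  where
    rep-incF : Increasing (λ i → RepPairs (F i) n)
    rep-incF = repPairs-increasing incF
    rep-incG : Increasing (λ i → RepPairs (G i) n)
    rep-incG = repPairs-increasing incG
    stage : ∃ λ N → ∀ {p} → p ∈ xs → RepPairs (F N) n p
    stage = common-stage rep-incF xs (repPairs-⋃⁻ incF ∘ from (xs-lists _))
    N : ℕ
    N = proj₁ stage
    -- from stage N on, the list xs enumerates the representations by F M
    size-F : ∀ {M} → N ≤ M → HasSize (RepPairs (F M) n) k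
    size-F {M} N≤M =
      ≐-size ((λ r → increasing-≤ rep-incF N≤M (proj₂ stage (to (xs-lists _) r))) ,
              repPairs-⋃⁺ F M) s
    size-G : ∀ {M} → N ≤ M → HasSize (RepPairs (G M) n) k
    size-G {M} N≤M = sameRep⇒transfer (same M) n (size-F N≤M)
    stable : RepPairs (⋃ ℕ G) n ⊆ RepPairs (G N) n
    stable r with repPairs-⋃⁻ incG r
    ... | i , rᵢ = full-subpredicate (≡-dec _≟_ _≟_) (increasing-≤ rep-incG (m≤n⊔m i N))
                     (size-G ≤-refl) (size-G (m≤n⊔m i N)) (increasing-≤ rep-incG (m≤m⊔n i N) rᵢ)

limit : {F G : ℕ → SetN} → Increasing F → Increasing G → (∀ i → SameRep (F i) (G i)) → SameRep (⋃ ℕ F) (⋃ ℕ G)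
limit incF incG same =
  transfers⇒sameRep (limit-transfer incF incG same) (limit-transfer incG incF (sameRep-sym ∘ same))

shifted-difference : ∀ m b → + (m + b) ℤ.- + b ≡ + m
shifted-difference m b = begin
  + (m + b) ℤ.- + b  ≡⟨ [+m]-[+n]≡m⊖n (m + b) b ⟩
  (m + b) ⊖ b        ≡⟨ ⊖-≥ (m≤n+m b m) ⟩
  + ((m + b) ∸ b)    ≡⟨ cong +_ (m+n∸n≡m m b) ⟩
  + m                ∎
  where open ≡-Reasoning

gap⇒disjoint : ¬ (A −ₛ B) (+ m) → A ⊥ (m +ₛ B)
gap⇒disjoint {m = m} gap (aa , b , bb , refl) = gap (m + b , b , aa , bb , sym (shifted-difference m b))

mainTheorem3 : (A₀ B₀ : SetN) (m : ℕ → ℕ) →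
    SameRep A₀ B₀ →
    (∀ i → ¬ (((Aseq A₀ B₀ m i) −ₛ (Bseq A₀ B₀ m i)) (+ m i) ⊎ ((Bseq A₀ B₀ m i) −ₛ (Aseq A₀ B₀ m i)) (+ m i))) →
    SameRep (Alim A₀ B₀ m) (Blim A₀ B₀ m)
mainTheorem3 A₀ B₀ m same gap = limit (increasing inj₁) (increasing inj₁) stages
  where
    stages : ∀ i → SameRep (Aseq A₀ B₀ m i) (Bseq A₀ B₀ m i)
    stages zero = same
    stages (suc i) = step (stages i) (gap⇒disjoint (gap i ∘ inj₁)) (gap⇒disjoint (gap i ∘ inj₂))
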